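{- Let $\Gamma$ be a strictly Deza graph with parameters $(n,k,b,a)$ such that $k=b+1$ and $\beta(\Gamma)>1$. Then $\alpha(\Gamma)>0$ and $b>a>0$.
   Context: Graphs are finite, simple, undirected. $N(v)$ is the neighbourhood of $v$. A Deza graph with parameters $(n,k,b,a)$, $b\ge a$, is a nonempty $k$-regular graph on $n$ vertices in which every pair of distinct vertices has exactly $b$ or exactly $a$ common neighbours; it is strictly Deza if it has diameter $2$ and is not strongly regular. $A(v)=\{u: |N(u)\cap N(v)|=a\}$, $B(v)=\{u: |N(u)\cap N(v)|=b\}$; for strictly Deza graphs $\alpha(\Gamma)=|A(v)|$ and $\beta(\Gamma)=|B(v)|$ are independent of $v$. -}

module Defs where

open import Data.Nat using (ℕ; zero; suc; _+_; _<_; _≤_; _≡ᵇ_)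
open import Data.Fin using (Fin; zero; suc)
open import Data.Bool using (Bool; true; false; _∧_; if_then_else_)
open import Data.Product using (Σ; ∃; _×_; _,_)
open import Data.Sum using (_⊎_)
open import Relation.Nullary using (¬_)
open import Relation.Binary.PropositionalEquality using (_≡_; _≢_)

count : {n : ℕ} → (Fin n → Bool) → ℕ
count {zero} p = 0
count {suc n} p = (if p zero then 1 else 0) + count (λ i → p (suc i))

record Graph (n : ℕ) : Set where
  field
    adj     : Fin n → Fin n → Bool
    adj-sym : ∀ u v → adj u v ≡ adj v u
    irrefl  : ∀ v → adj v v ≡ false
open Graph public

module _ {n : ℕ} (Γ : Graph n) where

  Adj : Fin n → Fin n → Set
  Adj u v = adj Γ u v ≡ true

  degree : Fin n → ℕ
  degree v = count (λ w → adj Γ v w)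

  common : Fin n → Fin n → ℕ
  common u v = count (λ w → adj Γ u w ∧ adj Γ v w)

  Regular : ℕ → Set
  Regular k = ∀ v → degree v ≡ k

  Diameter2 : Set
  Diameter2 =
    (∀ u v → u ≢ v → Adj u v ⊎ ∃ λ w → Adj u w × Adj w v)
    × (∃ λ u → ∃ λ v → u ≢ v × ¬ Adj u v)

  IsDeza : ℕ → ℕ → ℕ → Set
  IsDeza k b a =
    0 < n × Regular k × a ≤ b
    × (∀ u v → u ≢ v → common u v ≡ b ⊎ common u v ≡ a)

  IsSRG : ℕ → ℕ → ℕ → Set
  IsSRG k l m =
    Regular k
    × (∀ u v → u ≢ v → Adj u v → common u v ≡ l)
    × (∀ u v → u ≢ v → ¬ Adj u v → common u v ≡ m)

  StronglyRegular : Set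
  StronglyRegular = ∃ λ k → ∃ λ l → ∃ λ m → IsSRG k l m

  IsStrictlyDeza : ℕ → ℕ → ℕ → Set
  IsStrictlyDeza k b a = IsDeza k b a × Diameter2 × ¬ StronglyRegular

  αAt : ℕ → Fin n → ℕ
  αAt a v = count (λ u → common u v ≡ᵇ a)

  βAt : ℕ → Fin n → ℕ
  βAt b v = count (λ u → common u v ≡ᵇ b)

-- Because k = b + 1, a neighbour x of v with |N(x) ∩ N(v)| = b is adjacent to all other
-- neighbours of v. If every u ≠ v had b common neighbours with v, then (diameter 2) every such
-- u would be adjacent to v, and then any two vertices would be adjacent, which contradicts
-- diameter 2; hence α > 0. If a = b, Γ would be strongly regular. If a = 0, non-adjacent pairs
-- share a neighbour, so have b common neighbours; and adjacent u ~ v cannot have b: a vertex z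
-- with N(z) ∩ N(v) = ∅ lies in N(v), hence in N(u), so u ∈ N(z) ∩ N(v). Thus Γ would be
-- strongly regular with λ = 0, μ = b.
module Submission where

open import Defs
open import Algebra.Properties.CommutativeSemigroup using (x∙yz≈y∙xz)
open import Data.Bool using (Bool; true; false; _∧_; if_then_else_)
open import Data.Bool.Properties using (∧-comm; ∧-idem; ∧-conicalʳ; T-≡) renaming (_≟_ to _≟ᵇ_)
open import Data.Empty using (⊥; ⊥-elim)
open import Data.Fin using (Fin; zero; suc; _≟_)
open import Data.Nat using (ℕ; suc; _+_; _<_; _≤_; z≤n; s≤s; _≡ᵇ_)
open import Data.Nat.Properties
  using (≤-refl; ≤-trans; m≤n+m; +-mono-≤; ≤∧≢⇒<; n≢0⇒n>0; n>0⇒n≢0; 1+n≢0; 1+n≰n; _<?_;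
         ≡ᵇ⇒≡; ≡⇒≡ᵇ; +-commutativeSemigroup; module ≤-Reasoning)
open import Data.Product using (∃; _×_; _,_; proj₁; proj₂)
open import Data.Sum using (_⊎_; inj₁; inj₂)
open import Function using (_∘_; Equivalence)
open import Relation.Nullary using (¬_; Dec; yes; no; contradiction)
open import Relation.Binary.PropositionalEquality using (_≡_; _≢_; refl; sym; trans; cong; cong₂; subst)

private
  variable
    m : ℕ
    n : ℕ

≡⇒≡ᵇ-true : ∀ {i j} → i ≡ j → (i ≡ᵇ j) ≡ true
≡⇒≡ᵇ-true = Equivalence.to T-≡ ∘ ≡⇒≡ᵇ _ _

≡ᵇ-true⇒≡ : ∀ {i j} → (i ≡ᵇ j) ≡ true → i ≡ j
≡ᵇ-true⇒≡ = ≡ᵇ⇒≡ _ _ ∘ Equivalence.from T-≡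

_⊆ᵇ_ : (p q : Fin n → Bool) → Set
p ⊆ᵇ q = ∀ i → p i ≡ true → q i ≡ true

indicator-mono : ∀ {x y : Bool} → (x ≡ true → y ≡ true)
  → (if x then 1 else 0) ≤ (if y then 1 else 0)
indicator-mono {false} _ = z≤n
indicator-mono {true} x⇒y rewrite x⇒y refl = ≤-refl

count-cong : {p q : Fin n → Bool} → (∀ i → p i ≡ q i) → count p ≡ count q
count-cong {n = 0} p≗q = refl
count-cong {n = suc n} p≗q rewrite p≗q zero = cong (_ +_) (count-cong (p≗q ∘ suc))

count-step : {p q : Fin (suc n) → Bool} → p ⊆ᵇ q
  → m + count (p ∘ suc) ≤ count (q ∘ suc) → m + count p ≤ count q
count-step {m = m} {p = p} {q} p⊆q tail≤ = begin
  m + ((if p zero then 1 else 0) + count (p ∘ suc))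
    ≡⟨ x∙yz≈y∙xz +-commutativeSemigroup m (if p zero then 1 else 0) _ ⟩
  (if p zero then 1 else 0) + (m + count (p ∘ suc))
    ≤⟨ +-mono-≤ (indicator-mono (p⊆q zero)) tail≤ ⟩
  count q ∎
  where open ≤-Reasoning

count-mono : {p q : Fin n → Bool} → p ⊆ᵇ q → count p ≤ count q
count-mono {n = 0} _ = z≤n
count-mono {n = suc n} p⊆q = count-step {m = 0} p⊆q (count-mono (p⊆q ∘ suc))

count-< : {p q : Fin n → Bool} → p ⊆ᵇ q → ∀ i → q i ≡ true → p i ≡ false → count p < count q
count-< p⊆q zero qi pi rewrite qi | pi = s≤s (count-mono (p⊆q ∘ suc))
count-< p⊆q (suc i) qi pi = count-step {m = 1} p⊆q (count-< (p⊆q ∘ suc) i qi pi)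

count-<-2 : {p q : Fin n → Bool} → p ⊆ᵇ q → ∀ i j → i ≢ j
  → q i ≡ true → p i ≡ false → q j ≡ true → p j ≡ false → 2 + count p ≤ count q
count-<-2 _ zero zero i≢j _ _ _ _ = contradiction refl i≢j
count-<-2 p⊆q zero (suc j) _ qi pi qj pj rewrite qi | pi = s≤s (count-< (p⊆q ∘ suc) j qj pj)
count-<-2 p⊆q (suc i) zero _ qi pi qj pj rewrite qj | pj = s≤s (count-< (p⊆q ∘ suc) i qi pi)
count-<-2 p⊆q (suc i) (suc j) i≢j qi pi qj pj =
  count-step {m = 2} p⊆q (count-<-2 (p⊆q ∘ suc) i j (i≢j ∘ cong suc) qi pi qj pj)

count-pos : (p : Fin n → Bool) (i : Fin n) → p i ≡ true → 0 < count p
count-pos p zero pi rewrite pi = s≤s z≤n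
count-pos p (suc i) pi = ≤-trans (count-pos (p ∘ suc) i pi) (m≤n+m _ _)

count-witness : (p : Fin n → Bool) → 0 < count p → ∃ λ i → p i ≡ true
count-witness {n = suc n} p pos with p zero in p0
... | true = zero , p0
... | false with count-witness (p ∘ suc) pos
...   | i , pi = suc i , pi

module _ {n : ℕ} (Γ : Graph n) where

  Adj-sym : ∀ {u v} → Adj Γ u v → Adj Γ v u
  Adj-sym {u} {v} = trans (adj-sym Γ v u)

  ¬Adj-refl : ∀ {v} → ¬ Adj Γ v v
  ¬Adj-refl {v} vv = contradiction (trans (sym vv) (irrefl Γ v)) λ ()

  common-sym : ∀ u v → common Γ u v ≡ common Γ v u
  common-sym u v = count-cong λ w → ∧-comm (adj Γ u w) (adj Γ v w)

  common-self : ∀ v → common Γ v v ≡ degree Γ v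
  common-self v = count-cong λ w → ∧-idem (adj Γ v w)

  common-pos : ∀ {u w v} → Adj Γ u w → Adj Γ w v → 0 < common Γ u v
  common-pos {w = w} uw wv = count-pos _ w (cong₂ _∧_ uw (Adj-sym wv))

  -- N(x) ∩ N(v) ⊆ N(v) ∖ {x}, so equality of sizes forces every other neighbour of v into N(x).
  common≡degree-1⇒Adj : ∀ {x v w} → degree Γ v ≡ suc (common Γ x v)
    → Adj Γ v x → Adj Γ v w → w ≢ x → Adj Γ x w
  common≡degree-1⇒Adj {x} {v} {w} deg vx vw w≢x with adj Γ x w in xw
  ... | true = refl
  ... | false = ⊥-elim (1+n≰n (subst (2 + common Γ x v ≤_) deg
        (count-<-2 (λ y → ∧-conicalʳ (adj Γ x y) (adj Γ v y)) x w (w≢x ∘ sym) vx x∉ vw w∉)))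
    where
    x∉ : (adj Γ x x ∧ adj Γ v x) ≡ false
    x∉ rewrite irrefl Γ x = refl
    w∉ : (adj Γ x w ∧ adj Γ v w) ≡ false
    w∉ rewrite xw = refl

  constant-common⇒StronglyRegular : ∀ {k c} → Regular Γ k
    → (∀ u v → u ≢ v → common Γ u v ≡ c) → StronglyRegular Γ
  constant-common⇒StronglyRegular {k} reg const =
    k , _ , _ , reg , (λ u v u≢v _ → const u v u≢v) , (λ u v u≢v _ → const u v u≢v)

  IsDeza⇒a<b : ∀ {k b a} → IsDeza Γ k b a → ¬ StronglyRegular Γ → a < b
  IsDeza⇒a<b (_ , reg , a≤b , deza) ¬srg = ≤∧≢⇒< a≤b λ a≡b →
    ¬srg (constant-common⇒StronglyRegular reg λ u v u≢v → common≡b a≡b (deza u v u≢v))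
    where
    common≡b : ∀ {a b c} → a ≡ b → c ≡ b ⊎ c ≡ a → c ≡ b
    common≡b _ (inj₁ c≡b) = c≡b
    common≡b a≡b (inj₂ c≡a) = trans c≡a a≡b

  module _ {b : ℕ} (reg : Regular Γ (suc b)) (diam : Diameter2 Γ) where

    private
      Adj-or-path : ∀ u v → u ≢ v → Adj Γ u v ⊎ ∃ λ w → Adj Γ u w × Adj Γ w v
      Adj-or-path = proj₁ diam

      common≡b⇒Adj : ∀ {x v w} → common Γ x v ≡ b
        → Adj Γ v x → Adj Γ v w → w ≢ x → Adj Γ x w
      common≡b⇒Adj {v = v} c≡b = common≡degree-1⇒Adj (trans (reg v) (cong suc (sym c≡b)))

      universal-vertex : ∀ {v} → (∀ u → u ≢ v → common Γ u v ≡ b) → ∀ u → u ≢ v → Adj Γ v u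
      universal-vertex {v} all-b u u≢v with Adj-or-path u v u≢v
      ... | inj₁ uv = Adj-sym uv
      ... | inj₂ (w , uw , wv) = common≡b⇒Adj
        (trans (common-sym v w) (all-b w λ { refl → ¬Adj-refl wv })) wv (Adj-sym uw) u≢v

    ¬all-common≡b : ∀ {v} → ¬ (∀ u → u ≢ v → common Γ u v ≡ b)
    ¬all-common≡b {v} all-b = non-adjacent-pair (proj₂ diam)
      where
      adj-v : ∀ u → u ≢ v → Adj Γ v u
      adj-v = universal-vertex all-b

      non-adjacent-pair : ¬ (∃ λ x → ∃ λ y → x ≢ y × ¬ Adj Γ x y)
      non-adjacent-pair (x , y , x≢y , ¬xy) with x ≟ v | y ≟ v
      ... | yes refl | _ = ¬xy (adj-v y (x≢y ∘ sym))
      ... | no _ | yes refl = ¬xy (Adj-sym (adj-v x x≢y))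
      ... | no x≢v | no y≢v =
        ¬xy (common≡b⇒Adj (all-b x x≢v) (adj-v x x≢v) (adj-v y y≢v) (x≢y ∘ sym))

    module _ {a : ℕ} (deza : ∀ u v → u ≢ v → common Γ u v ≡ b ⊎ common Γ u v ≡ a) where

      α-pos : ∀ v → 0 < αAt Γ a v
      α-pos v with 0 <? αAt Γ a v
      ... | yes pos = pos
      ... | no ¬pos = ⊥-elim (¬all-common≡b all-b)
        where
        all-b : ∀ u → u ≢ v → common Γ u v ≡ b
        all-b u u≢v with deza u v u≢v
        ... | inj₁ c≡b = c≡b
        ... | inj₂ c≡a = contradiction (count-pos _ u (≡⇒≡ᵇ-true c≡a)) ¬pos

    module _ (0<b : 0 < b) (deza : ∀ u v → u ≢ v → common Γ u v ≡ b ⊎ common Γ u v ≡ 0) where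

      private
        ¬Adj⇒common≡b : ∀ u v → u ≢ v → ¬ Adj Γ u v → common Γ u v ≡ b
        ¬Adj⇒common≡b u v u≢v ¬uv with deza u v u≢v | Adj-or-path u v u≢v
        ... | inj₁ c≡b | _ = c≡b
        ... | inj₂ _ | inj₁ uv = contradiction uv ¬uv
        ... | inj₂ c≡0 | inj₂ (w , uw , wv) = contradiction c≡0 (n>0⇒n≢0 (common-pos uw wv))

        Adj⇒common≡0 : ∀ u v → u ≢ v → Adj Γ u v → common Γ u v ≡ 0
        Adj⇒common≡0 u v u≢v uv with deza u v u≢v
        ... | inj₂ c≡0 = c≡0
        ... | inj₁ c≡b = ⊥-elim (z-impossible (z ≟ u))
          where
          b≢0 : b ≢ 0
          b≢0 = n>0⇒n≢0 0<b

          A-witness : ∃ λ z → (common Γ z v ≡ᵇ 0) ≡ true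
          A-witness = count-witness (λ w → common Γ w v ≡ᵇ 0) (α-pos deza v)

          z : Fin n
          z = proj₁ A-witness

          cz≡0 : common Γ z v ≡ 0
          cz≡0 = ≡ᵇ-true⇒≡ (proj₂ A-witness)

          z≢v : z ≢ v
          z≢v z≡v = 1+n≢0
            (trans (sym (trans (common-self v) (reg v))) (subst (λ t → common Γ t v ≡ 0) z≡v cz≡0))

          vz : Adj Γ v z
          vz with adj Γ v z ≟ᵇ true
          ... | yes vz = vz
          ... | no ¬vz = ⊥-elim (b≢0 (trans (sym (¬Adj⇒common≡b z v z≢v (¬vz ∘ Adj-sym))) cz≡0))

          z-impossible : Dec (z ≡ u) → ⊥
          z-impossible (yes z≡u) = b≢0 (trans (sym c≡b) (subst (λ t → common Γ t v ≡ 0) z≡u cz≡0))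
          z-impossible (no z≢u) = n>0⇒n≢0
            (common-pos (Adj-sym (common≡b⇒Adj c≡b (Adj-sym uv) vz z≢u)) uv) cz≡0

      a≡0⇒StronglyRegular : StronglyRegular Γ
      a≡0⇒StronglyRegular =
        suc b , 0 , b , reg , Adj⇒common≡0 , ¬Adj⇒common≡b

lemma4 : (n k b a : ℕ) (Γ : Graph n) → IsStrictlyDeza Γ k b a → k ≡ suc b
    → (∀ v → 1 < βAt Γ b v)
    → (∀ v → 0 < αAt Γ a v) × (a < b) × (0 < a)
lemma4 n k b a Γ (dz@(_ , reg , _ , deza) , diam , ¬srg) refl _ =
  α-pos Γ reg diam deza , a<b , n≢0⇒n>0 λ { refl → ¬srg (a≡0⇒StronglyRegular Γ reg diam a<b deza) }
  where
  a<b : a < b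
  a<b = IsDeza⇒a<b Γ dz ¬srg
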